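{- Let $G$ be a connected graph of order $n \geq 6$ with minimum degree $\delta(G)\geq 2$. Suppose that (1) $G$ contains no subgraph isomorphic to $P_6$, but contains a subgraph isomorphic to $P_4$; and (2) whenever a vertex $x$ has degree $2$ with $N(x)=\{u,v\}$, we have $uv\in E(G)$. Then $G$ is isomorphic to the book $B_i$ for some $i\geq 4$, or $n$ is odd and $G$ is isomorphic to the fan $F_j$ for some $j\geq 3$.
   Context: All graphs are finite and simple. $P_k$ denotes the path on $k$ vertices; $N(x)$ is the set of neighbours of $x$. The book $B_k$ is the graph consisting of $k$ triangles sharing one common edge (so $B_k$ has $k+2$ vertices). The fan $F_k$ is the graph consisting of $k$ triangles sharing one common vertex and otherwise disjoint (so $F_k$ has $2k+1$ vertices). -}

module Defs where

open import Data.Nat using (ℕ; zero; suc; _+_; _∸_; _/_; _≡ᵇ_; _<ᵇ_)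
open import Data.Bool using (Bool; true; false; not; _∧_; _∨_; if_then_else_)
open import Data.Fin using (Fin; toℕ)
open import Data.List using (List; []; _∷_; map; allFin)
open import Data.Nat.ListAction using (sum)
open import Data.Product using (Σ; _×_; _,_; ∃)
open import Function.Definitions using (Injective)
open import Function.Bundles using (_↔_; Inverse)
open import Relation.Binary.PropositionalEquality using (_≡_; _≢_)

record Graph (n : ℕ) : Set where
  field
    Adj    : Fin n → Fin n → Bool
    sym    : ∀ x y → Adj x y ≡ Adj y x
    irrefl : ∀ x → Adj x x ≡ false
open Graph public

E : ∀ {n} → Graph n → Fin n → Fin n → Set
E G x y = Adj G x y ≡ true

degree : ∀ {n} → Graph n → Fin n → ℕ
degree {n} G x = sum (map (λ y → if Adj G x y then 1 else 0) (allFin n))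

MinDegreeAtLeast : ∀ {n} → Graph n → ℕ → Set
MinDegreeAtLeast G d = ∀ x → d Data.Nat.≤ degree G x

data Walk {n} (G : Graph n) : Fin n → Fin n → Set where
  here : ∀ {x} → Walk G x x
  step : ∀ {x y z} → E G x y → Walk G y z → Walk G x z

Connected : ∀ {n} → Graph n → Set
Connected G = ∀ x y → Walk G x y

ContainsPath : ∀ {n} → Graph n → ℕ → Set
ContainsPath {n} G k =
  Σ (Fin k → Fin n) λ f →
    Injective _≡_ _≡_ f ×
    (∀ i j → toℕ j ≡ suc (toℕ i) → E G (f i) (f j))

IsoTo : ∀ {n} → Graph n → (m : ℕ) → (Fin m → Fin m → Bool) → Set
IsoTo {n} G m A =
  Σ (Fin n ↔ Fin m) λ φ →
    ∀ x y → Adj G x y ≡ A (Inverse.to φ x) (Inverse.to φ y)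

-- Book B_k on Fin (k + 2): vertices 0,1 form the spine, each other vertex
-- is adjacent exactly to 0 and 1.
bookAdj : (k : ℕ) → Fin (k + 2) → Fin (k + 2) → Bool
bookAdj k x y =
  not (toℕ x ≡ᵇ toℕ y) ∧ ((toℕ x <ᵇ 2) ∨ (toℕ y <ᵇ 2))

-- Fan F_k on Fin (2k + 1): centre 0; for t < k the triangle is
-- {0, 2t+1, 2t+2}.
fanAdj : (k : ℕ) → Fin (suc (k + k)) → Fin (suc (k + k)) → Bool
fanAdj k x y =
  not (toℕ x ≡ᵇ toℕ y) ∧
  ((toℕ x ≡ᵇ 0) ∨ (toℕ y ≡ᵇ 0) ∨ (((toℕ x ∸ 1) / 2) ≡ᵇ ((toℕ y ∸ 1) / 2)))

-- With a 4-cycle abcd: a vertex x off the cycle that is adjacent to a has all its neighbours in {a, c},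
-- since a neighbour off the cycle would extend the path x a b c d to a P₆ and a neighbour b or d would
-- close a 5-cycle, which in a connected graph on at least six vertices also extends to a P₆. By
-- connectivity and minimum degree two every vertex off the cycle therefore has neighbourhood {a, c} or
-- {b, d}; the two kinds cannot occur together, the degree-two condition makes ac an edge, bd is no edge,
-- and G is the book with spine ac. Without 4-cycles the P₄ extends to a P₅ v₁v₂v₃v₄v₅ in which v₁v₂v₃
-- and v₃v₄v₅ are triangles; no P₆ may leave this bowtie, so v₃ is adjacent to every vertex, and every
-- other vertex lies in a triangle with v₃, unique as there is no 4-cycle: G is a fan with centre v₃.

module Submission where

open import Defs hiding (sym)
open import Data.Bool using (Bool; true; false; not; _∧_; _∨_; if_then_else_)
open import Data.Bool.Properties using (¬-not; ∧-zeroʳ) renaming (_≟_ to _≟ᵇ_)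
open import Data.Empty using (⊥; ⊥-elim)
open import Data.Fin using (Fin; zero; suc; toℕ; punchIn; punchOut; cast)
open import Data.Fin.Patterns using (0F; 1F; 2F; 3F)
open import Data.Fin.Permutation
  using (Permutation; Permutation′; _⟨$⟩ʳ_; _⟨$⟩ˡ_; inverseʳ; flip; insert; id; _∘ₚ_; cast-id)
open import Data.Fin.Properties
  using (_≟_; any?; 0≢1+n; suc-injective; pigeonhole; <⇒≢; ¬∀⟶∃¬; toℕ-cast;
         punchInᵢ≢i; punchIn-injective; punchIn-punchOut; punchOut-injective)
open import Data.List using (tabulate)
open import Data.List.Properties using (map-tabulate)
open import Data.Nat using (ℕ; zero; suc; pred; _+_; _≤_; _<_; _/_; _≡ᵇ_; _<ᵇ_; z≤n; s≤s)
open import Data.Nat.DivMod using (m/n≡1+[m∸n]/n)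
open import Data.Nat.ListAction using (sum)
open import Data.Nat.Properties using (+-suc; +-comm; ≤-pred; <⇒≤)
open import Data.Product using (Σ; ∃; ∃₂; _×_; _,_; proj₁; proj₂)
open import Data.Sum using (_⊎_; inj₁; inj₂; [_,_]′) renaming (map to ⊎-map; map₁ to ⊎-map₁; swap to ⊎-swap)
open import Data.Vec using (Vec; []; _∷_; _∷ʳ_; head; lookup)
open import Data.Vec.Membership.Propositional using (_∈_; _∉_; lose)
import Data.Vec.Membership.DecPropositional as DecMembership
open import Data.Vec.Relation.Unary.All using (All; []; _∷_)
open import Data.Vec.Relation.Unary.AllPairs using ([]; _∷_)
open import Data.Vec.Relation.Unary.Any as Any using (Any; here; there; index)
open import Data.Vec.Relation.Unary.Any.Properties using (lookup-index)
open import Data.Vec.Relation.Unary.Linked using (Linked; []; [-]; _∷_)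
open import Data.Vec.Relation.Unary.Unique.Propositional using (Unique)
open import Data.Vec.Relation.Unary.Unique.Propositional.Properties using (lookup-injective)
open import Function using (_∘_)
open import Level using (0ℓ)
open import Relation.Binary.PropositionalEquality
  using (_≡_; _≢_; refl; sym; trans; cong; cong₂; subst; ≢-sym; module ≡-Reasoning)
open import Relation.Nullary using (¬_; Dec; yes; no)
open import Relation.Nullary.Decidable using (_⊎-dec_; _×-dec_; ¬?; toSum)
open import Relation.Unary using (Pred; Decidable)

open ≡-Reasoning

module _ {n : ℕ} where
  open DecMembership (_≟_ {n}) public using (_∈?_)

-- Counting neighbours

count : ∀ {n} → (Fin n → Bool) → ℕ
count f = sum (tabulate (λ y → if f y then 1 else 0))

degree≡count : ∀ {n} (G : Graph n) x → degree G x ≡ count (Adj G x)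
degree≡count G x = cong sum (map-tabulate (λ y → y) (λ y → if Adj G x y then 1 else 0))

count-none : ∀ {n} (f : Fin n → Bool) → (∀ y → f y ≡ false) → count f ≡ 0
count-none {zero}  f none = refl
count-none {suc n} f none rewrite none zero = count-none (f ∘ suc) (none ∘ suc)

count-single : ∀ {n} (f : Fin n → Bool) {u} → f u ≡ true → (∀ y → f y ≡ true → y ≡ u) → count f ≡ 1
count-single {suc n} f {zero} fu only rewrite fu =
  cong suc (count-none (f ∘ suc) λ y → ¬-not λ e → 0≢1+n (sym (only (suc y) e)))
count-single {suc n} f {suc u} fu only rewrite ¬-not {f zero} (0≢1+n ∘ only zero) =
  count-single (f ∘ suc) fu (λ y e → suc-injective (only (suc y) e))

count-pair : ∀ {n} (f : Fin n → Bool) {u v} → u ≢ v → f u ≡ true → f v ≡ true →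
             (∀ y → f y ≡ true → y ≡ u ⊎ y ≡ v) → count f ≡ 2
count-pair f {zero} {zero} u≢v = ⊥-elim (u≢v refl)
count-pair f {zero} {suc v} _ fu fv only rewrite fu =
  cong suc (count-single (f ∘ suc) fv λ y e → [ (λ ()) , suc-injective ]′ (only (suc y) e))
count-pair f {suc u} {zero} _ fu fv only rewrite fv =
  cong suc (count-single (f ∘ suc) fu λ y e → [ suc-injective , (λ ()) ]′ (only (suc y) e))
count-pair f {suc u} {suc v} u≢v fu fv only rewrite ¬-not {f zero} ([ 0≢1+n , 0≢1+n ]′ ∘ only zero) =
  count-pair (f ∘ suc) (u≢v ∘ cong suc) fu fv λ y e → ⊎-map suc-injective suc-injective (only (suc y) e)

count-witness : ∀ {n} (f : Fin n → Bool) → 1 ≤ count f → ∃ λ u → f u ≡ true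
count-witness {suc n} f pos with f zero in e
... | true  = zero , e
... | false with count-witness (f ∘ suc) pos
...   | u , fu = suc u , fu

count-witnesses : ∀ {n} (f : Fin n → Bool) → 2 ≤ count f → ∃₂ λ u v → u ≢ v × f u ≡ true × f v ≡ true
count-witnesses {suc n} f two with f zero in e
... | true with count-witness (f ∘ suc) (≤-pred two)
...   | v , fv = zero , suc v , 0≢1+n , e , fv
count-witnesses {suc n} f two | false with count-witnesses (f ∘ suc) two
...   | u , v , u≢v , fu , fv = suc u , suc v , u≢v ∘ suc-injective , fu , fv

∉⇒All≢ : ∀ {A : Set} {k} {y : A} (vs : Vec A k) → y ∉ vs → All (y ≢_) vs
∉⇒All≢ []       _  = []
∉⇒All≢ (v ∷ vs) y∉ = y∉ ∘ here ∷ ∉⇒All≢ vs (y∉ ∘ there)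

∈-rotate : ∀ {A : Set} {k} {x y : A} {xs : Vec A k} → y ∈ xs ∷ʳ x → y ∈ x ∷ xs
∈-rotate {xs = []}    (here y≡x) = here y≡x
∈-rotate {xs = _ ∷ _} (here y≡v) = there (here y≡v)
∈-rotate {xs = _ ∷ _} (there y∈) with ∈-rotate y∈
... | here y≡x  = here y≡x
... | there y∈′ = there (there y∈′)

∉-rotate : ∀ {A : Set} {k} {x y : A} {xs : Vec A k} → y ∉ x ∷ xs → y ∉ xs ∷ʳ x
∉-rotate y∉ = y∉ ∘ ∈-rotate

fresh : ∀ {n k} (vs : Vec (Fin n) k) → k < n → ∃ λ y → y ∉ vs
fresh {n} vs k<n = ¬∀⟶∃¬ n (_∈ vs) (_∈? vs) covers⇒⊥
  where
  covers⇒⊥ : ¬ (∀ y → y ∈ vs)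
  covers⇒⊥ covers with pigeonhole k<n (index ∘ covers)
  ... | i , j , i<j , same = <⇒≢ i<j (begin
    i                            ≡⟨ lookup-index (covers i) ⟩
    lookup vs (index (covers i)) ≡⟨ cong (lookup vs) same ⟩
    lookup vs (index (covers j)) ≡⟨ lookup-index (covers j) ⟨
    j                            ∎)

-- Paths, cycles and neighbourhoods

module Basics {n : ℕ} (G : Graph n) where

  E-sym : ∀ {x y} → E G x y → E G y x
  E-sym {x} {y} = trans (Graph.sym G y x)

  E⇒≢ : ∀ {x y} → E G x y → x ≢ y
  E⇒≢ {x} xx refl with trans (sym xx) (Graph.irrefl G x)
  ... | ()

  E? : ∀ x y → Dec (E G x y)
  E? x y = Adj G x y ≟ᵇ true

  crossingEdge : ∀ {P : Pred (Fin n) 0ℓ} → Decidable P → ∀ {x y} → Walk G x y → P x → ¬ P y →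
                 ∃₂ λ s t → P s × ¬ P t × E G s t
  crossingEdge P? here                   Px ¬Py = ⊥-elim (¬Py Px)
  crossingEdge P? (step {y = z} xz walk) Px ¬Py with P? z
  ... | yes Pz = crossingEdge P? walk Pz ¬Py
  ... | no ¬Pz = _ , z , Px , ¬Pz , xz

  Path : ∀ {k} → Vec (Fin n) k → Set
  Path vs = Unique vs × Linked (E G) vs

  Path⇒ContainsPath : ∀ {k} {vs : Vec (Fin n) k} → Path vs → ContainsPath G k
  Path⇒ContainsPath {vs = vs} (unique , linked) =
    lookup vs , (λ {i} {j} → lookup-injective unique i j) , consecutive linked
    where
    consecutive : ∀ {k} {vs : Vec (Fin n) k} → Linked (E G) vs →
                  ∀ i j → toℕ j ≡ suc (toℕ i) → E G (lookup vs i) (lookup vs j)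
    consecutive {vs = _ ∷ _ ∷ _} (e ∷ _) zero    (suc zero)    _  = e
    consecutive                  (_ ∷ l) (suc i) (suc j)       eq = consecutive l i j (cong pred eq)
    consecutive                  _       zero    (suc (suc _)) ()
    consecutive                  _       _       zero          ()

  Path₅ : (v₁ v₂ v₃ v₄ v₅ : Fin n) → Set
  Path₅ v₁ v₂ v₃ v₄ v₅ = Path (v₁ ∷ v₂ ∷ v₃ ∷ v₄ ∷ v₅ ∷ [])

  path₅ : ∀ {v₁ v₂ v₃ v₄ v₅} → E G v₁ v₂ → E G v₂ v₃ → E G v₃ v₄ → E G v₄ v₅ →
          v₁ ≢ v₃ → v₁ ≢ v₄ → v₁ ≢ v₅ → v₂ ≢ v₄ → v₂ ≢ v₅ → v₃ ≢ v₅ → Path₅ v₁ v₂ v₃ v₄ v₅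
  path₅ e₁₂ e₂₃ e₃₄ e₄₅ d₁₃ d₁₄ d₁₅ d₂₄ d₂₅ d₃₅ =
    ( (E⇒≢ e₁₂ ∷ d₁₃ ∷ d₁₄ ∷ d₁₅ ∷ []) ∷ (E⇒≢ e₂₃ ∷ d₂₄ ∷ d₂₅ ∷ []) ∷ (E⇒≢ e₃₄ ∷ d₃₅ ∷ [])
    ∷ (E⇒≢ e₄₅ ∷ []) ∷ [] ∷ [])
    , e₁₂ ∷ e₂₃ ∷ e₃₄ ∷ e₄₅ ∷ [-]

  Cycle4 : (a b c d : Fin n) → Set
  Cycle4 a b c d = E G a b × E G b c × E G c d × E G d a × a ≢ c × b ≢ d

  Cycle4-rotate : ∀ {a b c d} → Cycle4 a b c d → Cycle4 b c d a
  Cycle4-rotate (ab , bc , cd , da , a≢c , b≢d) = bc , cd , da , ab , b≢d , ≢-sym a≢c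

  HasCycle4 : Set
  HasCycle4 = ∃ λ a → ∃ λ b → ∃ λ c → ∃ λ d → Cycle4 a b c d

  cycle4? : Dec HasCycle4
  cycle4? = any? λ a → any? λ b → any? λ c → any? λ d →
    E? a b ×-dec E? b c ×-dec E? c d ×-dec E? d a ×-dec ¬? (a ≟ c) ×-dec ¬? (b ≟ d)

  Cycle4⇒Path₅ : ∀ {a b c d x} → Cycle4 a b c d → x ∉ a ∷ b ∷ c ∷ d ∷ [] → E G x a → Path₅ x a b c d
  Cycle4⇒Path₅ (ab , bc , cd , da , a≢c , b≢d) x∉ xa =
    path₅ xa ab bc cd (x∉ ∘ there ∘ here) (x∉ ∘ there ∘ there ∘ here) (x∉ ∘ there ∘ there ∘ there ∘ here)
          a≢c (≢-sym (E⇒≢ da)) b≢d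

  Cycle5 : (v₀ v₁ v₂ v₃ v₄ : Fin n) → Set
  Cycle5 v₀ v₁ v₂ v₃ v₄ = E G v₀ v₁ × E G v₁ v₂ × E G v₂ v₃ × E G v₃ v₄ × E G v₄ v₀ ×
                          v₀ ≢ v₂ × v₀ ≢ v₃ × v₁ ≢ v₃ × v₁ ≢ v₄ × v₂ ≢ v₄

  Cycle5-rotate : ∀ {v₀ v₁ v₂ v₃ v₄} → Cycle5 v₀ v₁ v₂ v₃ v₄ → Cycle5 v₁ v₂ v₃ v₄ v₀
  Cycle5-rotate (e₀₁ , e₁₂ , e₂₃ , e₃₄ , e₄₀ , d₀₂ , d₀₃ , d₁₃ , d₁₄ , d₂₄) =
    e₁₂ , e₂₃ , e₃₄ , e₄₀ , e₀₁ , d₁₃ , d₁₄ , d₂₄ , ≢-sym d₀₂ , ≢-sym d₀₃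

  Cycle5⇒Path₅ : ∀ {v₀ v₁ v₂ v₃ v₄} → Cycle5 v₀ v₁ v₂ v₃ v₄ → Path₅ v₀ v₁ v₂ v₃ v₄
  Cycle5⇒Path₅ (e₀₁ , e₁₂ , e₂₃ , e₃₄ , e₄₀ , d₀₂ , d₀₃ , d₁₃ , d₁₄ , d₂₄) =
    path₅ e₀₁ e₁₂ e₂₃ e₃₄ d₀₂ d₀₃ (≢-sym (E⇒≢ e₄₀)) d₁₃ d₁₄ d₂₄

  NeighboursAmong : (x a c : Fin n) → Set
  NeighboursAmong x a c = ∀ y → E G x y → y ≡ a ⊎ y ≡ c

  NeighboursExactly : (x a c : Fin n) → Set
  NeighboursExactly x a c = E G x a × E G x c × NeighboursAmong x a c

  NeighboursAmong-swap : ∀ {x a c} → NeighboursAmong x a c → NeighboursAmong x c a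
  NeighboursAmong-swap among y xy = ⊎-swap (among y xy)

  NeighboursExactly⇒degree≡2 : ∀ {x a c} → a ≢ c → NeighboursExactly x a c → degree G x ≡ 2
  NeighboursExactly⇒degree≡2 {x} a≢c (xa , xc , among) =
    trans (degree≡count G x) (count-pair (Adj G x) a≢c xa xc among)

  module _ (δ≥2 : MinDegreeAtLeast G 2) where

    anotherNeighbour : ∀ x w → ∃ λ y → E G x y × y ≢ w
    anotherNeighbour x w with count-witnesses (Adj G x) (subst (2 ≤_) (degree≡count G x) (δ≥2 x))
    ... | u , v , u≢v , xu , xv with u ≟ w
    ...   | yes refl = v , xv , ≢-sym u≢v
    ...   | no u≢w   = u , xu , u≢w

    NeighboursAmong⇒Exactly : ∀ {x a c} → NeighboursAmong x a c → NeighboursExactly x a c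
    NeighboursAmong⇒Exactly {x} {a} among with anotherNeighbour x a
    ... | y , xy , y≢a with among y xy
    ...   | inj₁ y≡a = ⊥-elim (y≢a y≡a)
    ...   | inj₂ refl with anotherNeighbour x y
    ...     | z , xz , z≢c with among z xz
    ...       | inj₁ refl = xz , xy , among
    ...       | inj₂ z≡c  = ⊥-elim (z≢c z≡c)

  DegreeTwoNeighboursAdjacent : Set
  DegreeTwoNeighboursAdjacent = ∀ x u v → degree G x ≡ 2 → E G x u → E G x v → u ≢ v → E G u v

  IsBookSpine : Fin n → Fin n → Set
  IsBookSpine a c = E G a c × (∀ l → l ≢ a → l ≢ c → NeighboursExactly l a c)

  OneNeighbourBesides : Fin n → Fin n → Set
  OneNeighbourBesides c x = ∃ λ q → q ≢ c × E G x q × ∀ {q′} → q′ ≢ c → E G x q′ → q′ ≡ q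

  IsFanCentre : Fin n → Set
  IsFanCentre c = (∀ x → x ≢ c → E G x c) × (∀ x → x ≢ c → OneNeighbourBesides c x)

-- Relabelling onto books and fans

IsoTo-pullback : ∀ {n m} (G : Graph n) {B : Fin m → Fin m → Bool} (ρ : Permutation m n) →
                 (∀ x y → B x y ≡ Adj G (ρ ⟨$⟩ʳ x) (ρ ⟨$⟩ʳ y)) → IsoTo G m B
IsoTo-pullback G {B} ρ pulls = flip ρ , λ x y → begin
  Adj G x y                                      ≡⟨ cong₂ (Adj G) (inverseʳ ρ) (inverseʳ ρ) ⟨
  Adj G (ρ ⟨$⟩ʳ (ρ ⟨$⟩ˡ x)) (ρ ⟨$⟩ʳ (ρ ⟨$⟩ˡ y)) ≡⟨ pulls (ρ ⟨$⟩ˡ x) (ρ ⟨$⟩ˡ y) ⟨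
  B (ρ ⟨$⟩ˡ x) (ρ ⟨$⟩ˡ y)                        ∎

-- listing ψ sends 0 to a, 1 to c and 2 + x to others (ψ x), where others enumerates the
-- remaining vertices in increasing order.
module PairFirst {m} {a c : Fin (suc (suc m))} (a≢c : a ≢ c) where

  private
    c′ : Fin (suc m)
    c′ = punchOut a≢c

  others : Fin m → Fin (suc (suc m))
  others x = punchIn a (punchIn c′ x)

  others≢a : ∀ x → others x ≢ a
  others≢a x = punchInᵢ≢i a (punchIn c′ x)

  others≢c : ∀ x → others x ≢ c
  others≢c x eq = punchInᵢ≢i c′ x (punchIn-injective a _ _ (trans eq (sym (punchIn-punchOut a≢c))))

  others-injective : ∀ {x y} → others x ≡ others y → x ≡ y
  others-injective = punchIn-injective c′ _ _ ∘ punchIn-injective a _ _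

  others-surjective : ∀ {y} → y ≢ a → y ≢ c → ∃ λ x → others x ≡ y
  others-surjective {y} y≢a y≢c = punchOut c′≢y′ , (begin
    punchIn a (punchIn c′ (punchOut c′≢y′)) ≡⟨ cong (punchIn a) (punchIn-punchOut c′≢y′) ⟩
    punchIn a (punchOut a≢y)                ≡⟨ punchIn-punchOut a≢y ⟩
    y                                       ∎)
    where
    a≢y : a ≢ y
    a≢y = ≢-sym y≢a
    c′≢y′ : c′ ≢ punchOut a≢y
    c′≢y′ = y≢c ∘ sym ∘ punchOut-injective a≢c a≢y

  listing : Permutation′ m → Permutation′ (suc (suc m))
  listing ψ = insert 0F a (insert 0F c′ ψ)

  listing-1 : ∀ ψ → listing ψ ⟨$⟩ʳ 1F ≡ c
  listing-1 ψ = punchIn-punchOut a≢c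

record IsPerfectMatching {m} (B : Fin m → Fin m → Bool) : Set where
  field
    irreflexive    : ∀ x → B x x ≡ false
    symmetric      : ∀ x y → B x y ≡ B y x
    partner        : Fin m → Fin m
    partner-adj    : ∀ x → B x (partner x) ≡ true
    partner-unique : ∀ {x y} → B x y ≡ true → y ≡ partner x

  partner-involutive : ∀ x → partner (partner x) ≡ x
  partner-involutive x = sym (partner-unique (trans (symmetric _ x) (partner-adj x)))

  partner≢ : ∀ x → partner x ≢ x
  partner≢ x eq with trans (sym (partner-adj x)) (trans (cong (B x) eq) (irreflexive x))
  ... | ()

  non-partner : ∀ {x y} → y ≢ partner x → B x y ≡ false
  non-partner y≢ = ¬-not (y≢ ∘ partner-unique)

-- fanAdj k (suc i) (suc j) reduces to matchingAdj i j: the pairs are {2t, 2t + 1}.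
matchingAdj : ∀ {m} → Fin m → Fin m → Bool
matchingAdj i j = not (toℕ i ≡ᵇ toℕ j) ∧ (toℕ i / 2 ≡ᵇ toℕ j / 2)

StandardLabelling : ∀ {m} → (Fin m → Fin m → Bool) → Set
StandardLabelling {m} B =
  Σ ℕ λ k → m ≡ k + k × Σ (Permutation′ m) λ ψ → ∀ x y → matchingAdj x y ≡ B (ψ ⟨$⟩ʳ x) (ψ ⟨$⟩ʳ y)

[2+t]/2≡1+[t/2] : ∀ t → suc (suc t) / 2 ≡ suc (t / 2)
[2+t]/2≡1+[t/2] t = m/n≡1+[m∸n]/n {suc (suc t)} (s≤s (s≤s z≤n))

module _ {m} (i : Fin m) where

  matchingAdj-shift : ∀ j → matchingAdj (suc (suc i)) (suc (suc j)) ≡ matchingAdj i j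
  matchingAdj-shift j rewrite [2+t]/2≡1+[t/2] (toℕ i) | [2+t]/2≡1+[t/2] (toℕ j) = refl

  matchingAdj-0-2+ : matchingAdj 0F (suc (suc i)) ≡ false
  matchingAdj-0-2+ rewrite [2+t]/2≡1+[t/2] (toℕ i) = refl

  matchingAdj-1-2+ : matchingAdj 1F (suc (suc i)) ≡ false
  matchingAdj-1-2+ rewrite [2+t]/2≡1+[t/2] (toℕ i) = refl

  matchingAdj-2+-0 : matchingAdj (suc (suc i)) 0F ≡ false
  matchingAdj-2+-0 rewrite [2+t]/2≡1+[t/2] (toℕ i) = refl

  matchingAdj-2+-1 : matchingAdj (suc (suc i)) 1F ≡ false
  matchingAdj-2+-1 rewrite [2+t]/2≡1+[t/2] (toℕ i) = refl

module MatchingStep {m} {B : Fin (suc (suc m)) → Fin (suc (suc m)) → Bool} (M : IsPerfectMatching B) where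

  open IsPerfectMatching M
  open PairFirst (≢-sym (partner≢ 0F))

  rest : Fin m → Fin m → Bool
  rest x y = B (others x) (others y)

  rest-isPerfectMatching : IsPerfectMatching rest
  rest-isPerfectMatching = record
    { irreflexive    = λ x → irreflexive (others x)
    ; symmetric      = λ x y → symmetric (others x) (others y)
    ; partner        = λ x → proj₁ (restPartner x)
    ; partner-adj    = λ x → trans (cong (B (others x)) (proj₂ (restPartner x))) (partner-adj (others x))
    ; partner-unique = λ {x} xy → others-injective (trans (partner-unique xy) (sym (proj₂ (restPartner x))))
    }
    where
    restPartner : ∀ x → ∃ λ p → others p ≡ partner (others x)
    restPartner x = others-surjective ≢0 ≢partner0
      where
      ≢0 : partner (others x) ≢ 0F
      ≢0 eq = others≢c x (trans (sym (partner-involutive (others x))) (cong partner eq))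
      ≢partner0 : partner (others x) ≢ partner 0F
      ≢partner0 eq = others≢a x (begin
        others x                     ≡⟨ partner-involutive (others x) ⟨
        partner (partner (others x)) ≡⟨ cong partner eq ⟩
        partner (partner 0F)         ≡⟨ partner-involutive 0F ⟩
        0F                           ∎)

  extend : StandardLabelling rest → StandardLabelling B
  extend (k , m≡k+k , ψ , pulls) =
    suc k , trans (cong (2 +_) m≡k+k) (cong suc (sym (+-suc k k))) , ρ , pulls′
    where
    ρ : Permutation′ (suc (suc m))
    ρ = listing ψ

    0~1 : B 0F (ρ ⟨$⟩ʳ 1F) ≡ true
    0~1 = trans (cong (B 0F) (listing-1 ψ)) (partner-adj 0F)

    0≁others : ∀ x → B 0F (others x) ≡ false
    0≁others x = non-partner (others≢c x)

    1≁others : ∀ x → B (ρ ⟨$⟩ʳ 1F) (others x) ≡ false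
    1≁others x = trans (cong (λ v → B v (others x)) (listing-1 ψ))
                       (non-partner (others≢a x ∘ λ eq → trans eq (partner-involutive 0F)))

    pulls′ : ∀ x y → matchingAdj x y ≡ B (ρ ⟨$⟩ʳ x) (ρ ⟨$⟩ʳ y)
    pulls′ 0F            0F            = sym (irreflexive 0F)
    pulls′ 0F            1F            = sym 0~1
    pulls′ 1F            0F            = sym (trans (symmetric _ 0F) 0~1)
    pulls′ 1F            1F            = sym (irreflexive _)
    pulls′ 0F            (suc (suc j)) = trans (matchingAdj-0-2+ j) (sym (0≁others _))
    pulls′ 1F            (suc (suc j)) = trans (matchingAdj-1-2+ j) (sym (1≁others _))
    pulls′ (suc (suc i)) 0F            = trans (matchingAdj-2+-0 i) (sym (trans (symmetric _ 0F) (0≁others _)))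
    pulls′ (suc (suc i)) 1F            = trans (matchingAdj-2+-1 i) (sym (trans (symmetric _ _) (1≁others _)))
    pulls′ (suc (suc i)) (suc (suc j)) = trans (matchingAdj-shift i j) (pulls i j)

perfectMatching⇒standard : ∀ {m} {B : Fin m → Fin m → Bool} → IsPerfectMatching B → StandardLabelling B
perfectMatching⇒standard {zero}        _ = 0 , refl , id , λ ()
perfectMatching⇒standard {suc zero}    M with IsPerfectMatching.partner M 0F | IsPerfectMatching.partner≢ M 0F
... | zero | partner≢0 = ⊥-elim (partner≢0 refl)
perfectMatching⇒standard {suc (suc m)} M =
  MatchingStep.extend M (perfectMatching⇒standard (MatchingStep.rest-isPerfectMatching M))

-- bookAdj k x y is isBookEdge (toℕ x) (toℕ y); stated on ℕ so that it can be evaluated on Fin (2 + k).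
isBookEdge : ℕ → ℕ → Bool
isBookEdge i j = not (i ≡ᵇ j) ∧ ((i <ᵇ 2) ∨ (j <ᵇ 2))

bookSpine⇒IsoTo : ∀ {k} (G : Graph (suc (suc k))) {a c} → Basics.IsBookSpine G a c →
                  IsoTo G (k + 2) (bookAdj k)
bookSpine⇒IsoTo {k} G {a} {c} (ac , leaf) =
  IsoTo-pullback G (cast-id k+2≡2+k ∘ₚ ρ) λ x y →
    trans (cong₂ isBookEdge (sym (toℕ-cast k+2≡2+k x)) (sym (toℕ-cast k+2≡2+k y)))
          (pulls (cast k+2≡2+k x) (cast k+2≡2+k y))
  where
  open Basics G using (E-sym; E⇒≢; NeighboursExactly)
  open PairFirst (E⇒≢ ac)

  k+2≡2+k : k + 2 ≡ 2 + k
  k+2≡2+k = +-comm k 2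

  ρ : Permutation′ (suc (suc k))
  ρ = listing id

  ρ1 : ρ ⟨$⟩ʳ 1F ≡ c
  ρ1 = listing-1 id

  leaf′ : ∀ x → NeighboursExactly (others x) a c
  leaf′ x = leaf (others x) (others≢a x) (others≢c x)

  pulls : ∀ x y → isBookEdge (toℕ x) (toℕ y) ≡ Adj G (ρ ⟨$⟩ʳ x) (ρ ⟨$⟩ʳ y)
  pulls 0F            0F            = sym (Graph.irrefl G a)
  pulls 0F            1F            = sym (trans (cong (Adj G a) ρ1) ac)
  pulls 0F            (suc (suc j)) = sym (E-sym (proj₁ (leaf′ j)))
  pulls 1F            0F            = sym (trans (cong (λ v → Adj G v a) ρ1) (E-sym ac))
  pulls 1F            1F            = sym (Graph.irrefl G _)
  pulls 1F            (suc (suc j)) =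
    sym (trans (cong (λ v → Adj G v (others j)) ρ1) (E-sym (proj₁ (proj₂ (leaf′ j)))))
  pulls (suc (suc i)) 0F            = sym (proj₁ (leaf′ i))
  pulls (suc (suc i)) 1F            = sym (trans (cong (Adj G (others i)) ρ1) (proj₁ (proj₂ (leaf′ i))))
  pulls (suc (suc i)) (suc (suc j)) =
    trans (∧-zeroʳ _) (sym (¬-not λ e → [ others≢a j , others≢c j ]′ (proj₂ (proj₂ (leaf′ i)) _ e)))

IsFanCentre⇒matching : ∀ {m} (G : Graph (suc m)) {c} → Basics.IsFanCentre G c →
                       IsPerfectMatching (λ i j → Adj G (punchIn c i) (punchIn c j))
IsFanCentre⇒matching G {c} (_ , partnerOf) = record
  { irreflexive    = λ i → Graph.irrefl G (punchIn c i)
  ; symmetric      = λ i j → Graph.sym G (punchIn c i) (punchIn c j)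
  ; partner        = λ i → punchOut (c≢q i)
  ; partner-adj    = λ i → trans (cong (Adj G (punchIn c i)) (punchIn-punchOut (c≢q i)))
                                 (proj₁ (proj₂ (proj₂ (nearest i))))
  ; partner-unique = λ {i} {j} ij → punchIn-injective c _ _
      (trans (proj₂ (proj₂ (proj₂ (nearest i))) (punchInᵢ≢i c j) ij) (sym (punchIn-punchOut (c≢q i))))
  }
  where
  nearest : ∀ i → Basics.OneNeighbourBesides G c (punchIn c i)
  nearest i = partnerOf (punchIn c i) (punchInᵢ≢i c i)
  c≢q : ∀ i → c ≢ proj₁ (nearest i)
  c≢q i = ≢-sym (proj₁ (proj₂ (nearest i)))

fanCentre⇒IsoTo : ∀ {n} (G : Graph n) {c} → Basics.IsFanCentre G c →
                  Σ ℕ λ k → n ≡ suc (k + k) × IsoTo G (suc (k + k)) (fanAdj k)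
fanCentre⇒IsoTo {suc m} G {c} fan with perfectMatching⇒standard (IsFanCentre⇒matching G fan)
... | k , refl , ψ , pulls = k , refl , IsoTo-pullback G ρ pullsFan
  where
  ρ : Permutation′ (suc (k + k))
  ρ = insert 0F c ψ

  pullsFan : ∀ x y → fanAdj k x y ≡ Adj G (ρ ⟨$⟩ʳ x) (ρ ⟨$⟩ʳ y)
  pullsFan 0F      0F      = sym (Graph.irrefl G c)
  pullsFan 0F      (suc j) = sym (Basics.E-sym G (proj₁ fan _ (punchInᵢ≢i c _)))
  pullsFan (suc i) 0F      = sym (proj₁ fan _ (punchInᵢ≢i c _))
  pullsFan (suc i) (suc j) = pulls i j

-- Graphs without P₆

record Hypotheses {n} (G : Graph n) : Set where
  field
    noP₆      : ¬ ContainsPath G 6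
    connected : Connected G
    5<n       : 5 < n
    δ≥2       : MinDegreeAtLeast G 2

module WithoutP₆ {n} {G : Graph n} (H : Hypotheses G) where

  open Hypotheses H
  open Basics G

  pendant∈ : ∀ {y} {vs : Vec (Fin n) 5} → Path vs → E G y (head vs) → y ∈ vs
  pendant∈ {y} {vs} (unique , linked) y~ with y ∈? vs
  ... | yes y∈ = y∈
  ... | no y∉  = ⊥-elim (noP₆ (Path⇒ContainsPath (∉⇒All≢ vs y∉ ∷ unique , y~ ∷ linked)))

  Cycle5-closed : ∀ {v₀ v₁ v₂ v₃ v₄ s t} → Cycle5 v₀ v₁ v₂ v₃ v₄ →
                  s ∈ v₀ ∷ v₁ ∷ v₂ ∷ v₃ ∷ v₄ ∷ [] → E G s t → t ∈ v₀ ∷ v₁ ∷ v₂ ∷ v₃ ∷ v₄ ∷ []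
  Cycle5-closed C (here refl) st =
    pendant∈ (Cycle5⇒Path₅ C) (E-sym st)
  Cycle5-closed C (there (here refl)) st =
    ∈-rotate (pendant∈ (Cycle5⇒Path₅ (Cycle5-rotate C)) (E-sym st))
  Cycle5-closed C (there (there (here refl))) st =
    ∈-rotate (∈-rotate (pendant∈ (Cycle5⇒Path₅ (Cycle5-rotate (Cycle5-rotate C))) (E-sym st)))
  Cycle5-closed C (there (there (there (here refl)))) st =
    ∈-rotate (∈-rotate (∈-rotate
      (pendant∈ (Cycle5⇒Path₅ (Cycle5-rotate (Cycle5-rotate (Cycle5-rotate C)))) (E-sym st))))
  Cycle5-closed C (there (there (there (there (here refl))))) st =
    ∈-rotate (∈-rotate (∈-rotate (∈-rotate
      (pendant∈ (Cycle5⇒Path₅ (Cycle5-rotate (Cycle5-rotate (Cycle5-rotate (Cycle5-rotate C))))) (E-sym st)))))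

  noCycle5 : ∀ {v₀ v₁ v₂ v₃ v₄} → ¬ Cycle5 v₀ v₁ v₂ v₃ v₄
  noCycle5 {v₀} {v₁} {v₂} {v₃} {v₄} C with fresh (v₀ ∷ v₁ ∷ v₂ ∷ v₃ ∷ v₄ ∷ []) 5<n
  ... | y , y∉ with crossingEdge (_∈? v₀ ∷ v₁ ∷ v₂ ∷ v₃ ∷ v₄ ∷ []) (connected v₀ y) (here refl) y∉
  ...   | s , t , s∈ , t∉ , st = t∉ (Cycle5-closed C s∈ st)

  no-consecutive-neighbours : ∀ {a b c d x} → Cycle4 a b c d → x ∉ a ∷ b ∷ c ∷ d ∷ [] →
                              E G x a → E G x b → ⊥
  no-consecutive-neighbours (ab , bc , cd , da , a≢c , b≢d) x∉ xa xb =
    noCycle5 ( xa , E-sym da , E-sym cd , E-sym bc , E-sym xb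
             , x∉ ∘ there ∘ there ∘ there ∘ here , x∉ ∘ there ∘ there ∘ here , a≢c , E⇒≢ ab , ≢-sym b≢d)

  outsider-neighbours : ∀ {a b c d x} → Cycle4 a b c d → x ∉ a ∷ b ∷ c ∷ d ∷ [] →
                        E G x a → NeighboursAmong x a c
  outsider-neighbours {a} {b} {c} {d} C x∉ xa y xy with y ∈? a ∷ b ∷ c ∷ d ∷ []
  ... | yes (here y≡a)                 = inj₁ y≡a
  ... | yes (there (here refl))        = ⊥-elim (no-consecutive-neighbours C x∉ xa xy)
  ... | yes (there (there (here y≡c))) = inj₂ y≡c
  ... | yes (there (there (there (here refl)))) =
    ⊥-elim (no-consecutive-neighbours (Cycle4-rotate (Cycle4-rotate (Cycle4-rotate C)))
                                      (∉-rotate (∉-rotate (∉-rotate x∉))) xy xa)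
  ... | no y∉ with pendant∈ (Cycle4⇒Path₅ C x∉ xa) (E-sym xy)
  ...   | here refl = ⊥-elim (E⇒≢ xy refl)
  ...   | there y∈  = ⊥-elim (y∉ y∈)

  outsider-type : ∀ {a b c d x} → Cycle4 a b c d → x ∉ a ∷ b ∷ c ∷ d ∷ [] →
                  Any (E G x) (a ∷ b ∷ c ∷ d ∷ []) → NeighboursAmong x a c ⊎ NeighboursAmong x b d
  outsider-type C x∉ (here xa) = inj₁ (outsider-neighbours C x∉ xa)
  outsider-type C x∉ (there (here xb)) = inj₂ (outsider-neighbours (Cycle4-rotate C) (∉-rotate x∉) xb)
  outsider-type C x∉ (there (there (here xc))) =
    inj₁ (NeighboursAmong-swap
      (outsider-neighbours (Cycle4-rotate (Cycle4-rotate C)) (∉-rotate (∉-rotate x∉)) xc))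
  outsider-type C x∉ (there (there (there (here xd)))) =
    inj₂ (NeighboursAmong-swap
      (outsider-neighbours (Cycle4-rotate (Cycle4-rotate (Cycle4-rotate C)))
                           (∉-rotate (∉-rotate (∉-rotate x∉))) xd))

  near-square-closed : ∀ {a b c d s t} → Cycle4 a b c d →
                       s ∈ a ∷ b ∷ c ∷ d ∷ [] ⊎ Any (E G s) (a ∷ b ∷ c ∷ d ∷ []) → E G s t →
                       t ∈ a ∷ b ∷ c ∷ d ∷ [] ⊎ Any (E G t) (a ∷ b ∷ c ∷ d ∷ [])
  near-square-closed {a} {b} {c} {d} {s} {t} C s-near st with s ∈? a ∷ b ∷ c ∷ d ∷ [] | s-near
  ... | yes s∈ | _          = inj₂ (lose s∈ (E-sym st))
  ... | no s∉  | inj₁ s∈    = ⊥-elim (s∉ s∈)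
  ... | no s∉  | inj₂ touch = inj₁ ([ (λ among → [ here , there ∘ there ∘ here ]′ (among t st))
                                     , (λ among → [ there ∘ here , there ∘ there ∘ there ∘ here ]′ (among t st))
                                     ]′ (outsider-type C s∉ touch))

  outsider-touches : ∀ {a b c d x} → Cycle4 a b c d → x ∉ a ∷ b ∷ c ∷ d ∷ [] →
                     Any (E G x) (a ∷ b ∷ c ∷ d ∷ [])
  outsider-touches {a} {b} {c} {d} {x} C x∉ with Any.any? (E? x) (a ∷ b ∷ c ∷ d ∷ [])
  ... | yes touch = touch
  ... | no ¬touch with crossingEdge (λ z → z ∈? a ∷ b ∷ c ∷ d ∷ [] ⊎-dec Any.any? (E? z) (a ∷ b ∷ c ∷ d ∷ []))
                                    (connected a x) (inj₁ (here refl)) [ x∉ , ¬touch ]′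
  ...   | s , t , s-near , t-far , st = ⊥-elim (t-far (near-square-closed C s-near st))

  outsider-class : ∀ {a b c d x} → Cycle4 a b c d → x ∉ a ∷ b ∷ c ∷ d ∷ [] →
                   NeighboursAmong x a c ⊎ NeighboursAmong x b d
  outsider-class C x∉ = outsider-type C x∉ (outsider-touches C x∉)

  mixed-outsiders⇒⊥ : ∀ {a b c d x y} → Cycle4 a b c d → x ∉ a ∷ b ∷ c ∷ d ∷ [] → y ∉ a ∷ b ∷ c ∷ d ∷ [] →
                      NeighboursExactly x a c → NeighboursExactly y b d → ⊥
  mixed-outsiders⇒⊥ (ab , bc , cd , da , a≢c , b≢d) x∉ y∉ (xa , xc , x-among) (yb , _ , _)
    with pendant∈ (path₅ (E-sym ab) (E-sym xa) xc cd (≢-sym (x∉ ∘ there ∘ here)) (E⇒≢ bc) b≢d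
                         a≢c (≢-sym (E⇒≢ da)) (x∉ ∘ there ∘ there ∘ there ∘ here)) yb
  ... | here refl                                  = E⇒≢ yb refl
  ... | there (here y≡a)                           = y∉ (here y≡a)
  ... | there (there (here refl))                  = [ E⇒≢ ab ∘ sym , E⇒≢ bc ]′ (x-among _ yb)
  ... | there (there (there (here y≡c)))           = y∉ (there (there (here y≡c)))
  ... | there (there (there (there (here y≡d))))   = y∉ (there (there (there (here y≡d))))

  spine-from-outsider : ∀ {a b c d x₀} → DegreeTwoNeighboursAdjacent → Cycle4 a b c d →
                        x₀ ∉ a ∷ b ∷ c ∷ d ∷ [] → NeighboursAmong x₀ a c → IsBookSpine a c
  spine-from-outsider {a} {b} {c} {d} {x₀} deg2 C@(ab , bc , cd , da , a≢c , b≢d) x₀∉ x₀-among = ac , leaf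
    where
    x₀-exactly : NeighboursExactly x₀ a c
    x₀-exactly = NeighboursAmong⇒Exactly δ≥2 x₀-among

    outsider : ∀ {x} → x ∉ a ∷ b ∷ c ∷ d ∷ [] → NeighboursExactly x a c
    outsider x∉ with outsider-class C x∉
    ... | inj₁ among = NeighboursAmong⇒Exactly δ≥2 among
    ... | inj₂ among = ⊥-elim (mixed-outsiders⇒⊥ C x₀∉ x∉ x₀-exactly (NeighboursAmong⇒Exactly δ≥2 among))

    ac : E G a c
    ac = deg2 x₀ a c (NeighboursExactly⇒degree≡2 a≢c x₀-exactly)
              (proj₁ x₀-exactly) (proj₁ (proj₂ x₀-exactly)) a≢c

    b≁d : ¬ E G b d
    b≁d bd with fresh (x₀ ∷ a ∷ b ∷ c ∷ d ∷ []) 5<n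
    ... | y , y∉ with pendant∈ (path₅ (E-sym (proj₁ x₀-exactly)) (proj₁ (proj₂ x₀-exactly)) (E-sym bc) bd
                                      a≢c (E⇒≢ ab) (≢-sym (E⇒≢ da)) (x₀∉ ∘ there ∘ here)
                                      (x₀∉ ∘ there ∘ there ∘ there ∘ here) (E⇒≢ cd))
                               (proj₁ (outsider (y∉ ∘ there)))
    ...   | here y≡a                                 = y∉ (there (here y≡a))
    ...   | there (here y≡x₀)                        = y∉ (here y≡x₀)
    ...   | there (there (here y≡c))                 = y∉ (there (there (there (here y≡c))))
    ...   | there (there (there (here y≡b)))         = y∉ (there (there (here y≡b)))
    ...   | there (there (there (there (here y≡d)))) = y∉ (there (there (there (there (here y≡d)))))

    corner : ∀ {v} → v ≢ a → v ≢ c → (∀ {y} → y ∈ a ∷ b ∷ c ∷ d ∷ [] → E G v y → y ≡ a ⊎ y ≡ c) →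
             NeighboursExactly v a c
    corner {v} v≢a v≢c on-square = NeighboursAmong⇒Exactly δ≥2 among
      where
      among : NeighboursAmong v a c
      among y vy with y ∈? a ∷ b ∷ c ∷ d ∷ []
      ... | yes y∈ = on-square y∈ vy
      ... | no y∉  = ⊥-elim ([ v≢a , v≢c ]′ (proj₂ (proj₂ (outsider y∉)) v (E-sym vy)))

    leaf : ∀ l → l ≢ a → l ≢ c → NeighboursExactly l a c
    leaf l l≢a l≢c with l ∈? a ∷ b ∷ c ∷ d ∷ []
    ... | no l∉                          = outsider l∉
    ... | yes (here l≡a)                 = ⊥-elim (l≢a l≡a)
    ... | yes (there (there (here l≡c))) = ⊥-elim (l≢c l≡c)
    ... | yes (there (here refl)) = corner (≢-sym (E⇒≢ ab)) (E⇒≢ bc) λ where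
      (here y≡a)                         _  → inj₁ y≡a
      (there (here refl))                by → ⊥-elim (E⇒≢ by refl)
      (there (there (here y≡c)))         _  → inj₂ y≡c
      (there (there (there (here refl)))) bd → ⊥-elim (b≁d bd)
    ... | yes (there (there (there (here refl)))) = corner (E⇒≢ da) (≢-sym (E⇒≢ cd)) λ where
      (here y≡a)                          _  → inj₁ y≡a
      (there (here refl))                 db → ⊥-elim (b≁d (E-sym db))
      (there (there (here y≡c)))          _  → inj₂ y≡c
      (there (there (there (here refl)))) dy → ⊥-elim (E⇒≢ dy refl)

  cycle4⇒bookSpine : ∀ {a b c d} → DegreeTwoNeighboursAdjacent → Cycle4 a b c d → ∃₂ IsBookSpine
  cycle4⇒bookSpine {a} {b} {c} {d} deg2 C with fresh (a ∷ b ∷ c ∷ d ∷ []) (<⇒≤ 5<n)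
  ... | x , x∉ with outsider-class C x∉
  ...   | inj₁ among = a , c , spine-from-outsider deg2 C x∉ among
  ...   | inj₂ among = b , d , spine-from-outsider deg2 (Cycle4-rotate C) (∉-rotate x∉) among

  module _ (noC4 : ¬ HasCycle4) where

    private
      noCycle4 : ∀ {a b c d} → ¬ Cycle4 a b c d
      noCycle4 C = noC4 (_ , _ , _ , _ , C)

    extend-path₄ : ∀ {v₁ v₂ v₃ v₄} → E G v₁ v₂ → E G v₂ v₃ → E G v₃ v₄ → v₁ ≢ v₃ → v₁ ≢ v₄ → v₂ ≢ v₄ →
                   ∃ λ (vs : Vec (Fin n) 5) → Path vs
    extend-path₄ {v₁} {v₂} {v₃} {v₄} e₁₂ e₂₃ e₃₄ d₁₃ d₁₄ d₂₄ with anotherNeighbour δ≥2 v₁ v₂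
    ... | y , v₁y , y≢v₂ with y ≟ v₃ | y ≟ v₄
    ...   | _        | yes refl = ⊥-elim (noCycle4 (e₁₂ , e₂₃ , e₃₄ , E-sym v₁y , d₁₃ , d₂₄))
    ...   | no y≢v₃  | no y≢v₄  = _ , path₅ (E-sym v₁y) e₁₂ e₂₃ e₃₄ y≢v₂ y≢v₃ y≢v₄ d₁₃ d₁₄ d₂₄
    ...   | yes refl | no _ with anotherNeighbour δ≥2 v₄ v₃
    ...     | z , v₄z , z≢v₃ with z ≟ v₁ | z ≟ v₂
    ...       | yes refl | _        = ⊥-elim (noCycle4 (e₁₂ , e₂₃ , e₃₄ , v₄z , d₁₃ , d₂₄))
    ...       | no _     | yes refl =
      ⊥-elim (noCycle4 (e₁₂ , E-sym v₄z , E-sym e₃₄ , E-sym v₁y , d₁₄ , E⇒≢ e₂₃))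
    ...       | no z≢v₁  | no z≢v₂  =
      _ , path₅ e₁₂ e₂₃ e₃₄ v₄z d₁₃ d₁₄ (≢-sym z≢v₁) d₂₄ (≢-sym z≢v₂) (≢-sym z≢v₃)

    path₄⇒path₅ : ContainsPath G 4 → ∃ λ (vs : Vec (Fin n) 5) → Path vs
    path₄⇒path₅ (f , f-injective , f-edges) =
      extend-path₄ (f-edges 0F 1F refl) (f-edges 1F 2F refl) (f-edges 2F 3F refl)
                   (distinct {0F} {2F} λ ()) (distinct {0F} {3F} λ ()) (distinct {1F} {3F} λ ())
      where
      distinct : ∀ {i j} → i ≢ j → f i ≢ f j
      distinct i≢j = i≢j ∘ f-injective

    path₅-end : ∀ {v₁ v₂ v₃ v₄ v₅} → Path₅ v₁ v₂ v₃ v₄ v₅ → NeighboursAmong v₁ v₂ v₃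
    path₅-end P@( ((_ ∷ d₁₃ ∷ d₁₄ ∷ _ ∷ []) ∷ (_ ∷ d₂₄ ∷ d₂₅ ∷ []) ∷ (_ ∷ d₃₅ ∷ []) ∷ _)
                , e₁₂ ∷ e₂₃ ∷ e₃₄ ∷ e₄₅ ∷ [-]) y v₁y
      with pendant∈ P (E-sym v₁y)
    ... | here refl                 = ⊥-elim (E⇒≢ v₁y refl)
    ... | there (here y≡v₂)         = inj₁ y≡v₂
    ... | there (there (here y≡v₃)) = inj₂ y≡v₃
    ... | there (there (there (here refl))) =
      ⊥-elim (noCycle4 (e₁₂ , e₂₃ , e₃₄ , E-sym v₁y , d₁₃ , d₂₄))
    ... | there (there (there (there (here refl)))) =
      ⊥-elim (noCycle5 (e₁₂ , e₂₃ , e₃₄ , e₄₅ , E-sym v₁y , d₁₃ , d₁₄ , d₂₄ , d₂₅ , d₃₅))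

    path₅-chord : ∀ {v₁ v₂ v₃ v₄ v₅} → Path₅ v₁ v₂ v₃ v₄ v₅ → E G v₁ v₃
    path₅-chord {v₁} {v₂} P with anotherNeighbour δ≥2 v₁ v₂
    ... | y , v₁y , y≢v₂ with path₅-end P y v₁y
    ...   | inj₁ y≡v₂ = ⊥-elim (y≢v₂ y≡v₂)
    ...   | inj₂ refl = v₁y

    path₅-second : ∀ {v₁ v₂ v₃ v₄ v₅} → Path₅ v₁ v₂ v₃ v₄ v₅ → E G v₁ v₃ → E G v₅ v₃ →
                   NeighboursAmong v₂ v₁ v₃
    path₅-second ( ((_ ∷ _ ∷ d₁₄ ∷ d₁₅ ∷ []) ∷ (d₂₃ ∷ d₂₄ ∷ d₂₅ ∷ []) ∷ (_ ∷ d₃₅ ∷ []) ∷ _)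
                 , e₁₂ ∷ _ ∷ e₃₄ ∷ e₄₅ ∷ [-]) v₁v₃ v₅v₃ y v₂y
      with pendant∈ (path₅ (E-sym e₁₂) v₁v₃ e₃₄ e₄₅ d₂₃ d₂₄ d₂₅ d₁₄ d₁₅ d₃₅) (E-sym v₂y)
    ... | here refl                 = ⊥-elim (E⇒≢ v₂y refl)
    ... | there (here y≡v₁)         = inj₁ y≡v₁
    ... | there (there (here y≡v₃)) = inj₂ y≡v₃
    ... | there (there (there (here refl))) =
      ⊥-elim (noCycle4 (v₂y , E-sym e₃₄ , E-sym v₁v₃ , e₁₂ , d₂₃ , ≢-sym d₁₄))
    ... | there (there (there (there (here refl)))) =
      ⊥-elim (noCycle4 (v₂y , v₅v₃ , E-sym v₁v₃ , e₁₂ , d₂₃ , ≢-sym d₁₅))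

    -- v₁v₂v₃ and v₃v₄v₅ turn out to be triangles; wings lists their vertices other than v₃.
    module Bowtie {v₁ v₂ v₃ v₄ v₅}
      (e₁₂ : E G v₁ v₂) (e₂₃ : E G v₂ v₃) (e₃₄ : E G v₃ v₄) (e₄₅ : E G v₄ v₅)
      (d₁₃ : v₁ ≢ v₃) (d₁₄ : v₁ ≢ v₄) (d₁₅ : v₁ ≢ v₅) (d₂₄ : v₂ ≢ v₄) (d₂₅ : v₂ ≢ v₅) (d₃₅ : v₃ ≢ v₅) where

      P : Path₅ v₁ v₂ v₃ v₄ v₅
      P = path₅ e₁₂ e₂₃ e₃₄ e₄₅ d₁₃ d₁₄ d₁₅ d₂₄ d₂₅ d₃₅

      Pʳ : Path₅ v₅ v₄ v₃ v₂ v₁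
      Pʳ = path₅ (E-sym e₄₅) (E-sym e₃₄) (E-sym e₂₃) (E-sym e₁₂)
                 (≢-sym d₃₅) (≢-sym d₂₅) (≢-sym d₁₅) (≢-sym d₂₄) (≢-sym d₁₄) (≢-sym d₁₃)

      v₁v₃ : E G v₁ v₃
      v₁v₃ = path₅-chord P

      v₅v₃ : E G v₅ v₃
      v₅v₃ = path₅-chord Pʳ

      wings : Vec (Fin n) 4
      wings = v₁ ∷ v₂ ∷ v₄ ∷ v₅ ∷ []

      wings-closed : ∀ {w y} → w ∈ wings → E G w y → y ∈ wings ⊎ y ≡ v₃
      wings-closed (here refl)                         wy = ⊎-map₁ (there ∘ here) (path₅-end P _ wy)
      wings-closed (there (here refl))                 wy = ⊎-map₁ here (path₅-second P v₁v₃ v₅v₃ _ wy)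
      wings-closed (there (there (here refl)))         wy =
        ⊎-map₁ (there ∘ there ∘ there ∘ here) (path₅-second Pʳ v₅v₃ v₁v₃ _ wy)
      wings-closed (there (there (there (here refl)))) wy = ⊎-map₁ (there ∘ there ∘ here) (path₅-end Pʳ _ wy)

      wings-centre : ∀ {w} → w ∈ wings → E G w v₃
      wings-centre (here refl)                         = v₁v₃
      wings-centre (there (here refl))                 = e₂₃
      wings-centre (there (there (here refl)))         = E-sym e₃₄
      wings-centre (there (there (there (here refl)))) = v₅v₃

      ∉wings-by-neighbour : ∀ {y z} → y ∉ wings → y ≢ v₃ → E G z y → z ∉ wings
      ∉wings-by-neighbour y∉ y≢v₃ zy z∈ = [ y∉ , y≢v₃ ]′ (wings-closed z∈ zy)

      -- p a b v₃ v₁ v₂ would be a P₆.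
      outer-path⇒⊥ : ∀ {p a b} → E G p a → E G a b → E G b v₃ →
                     p ∉ wings → a ∉ wings → b ∉ wings → p ≢ b → p ≢ v₃ → a ≢ v₃ → ⊥
      outer-path⇒⊥ pa ab bv₃ p∉ a∉ b∉ p≢b p≢v₃ a≢v₃
        with pendant∈ (path₅ ab bv₃ (E-sym v₁v₃) e₁₂ a≢v₃ (a∉ ∘ here) (a∉ ∘ there ∘ here)
                             (b∉ ∘ here) (b∉ ∘ there ∘ here) (≢-sym (E⇒≢ e₂₃))) pa
      ... | here refl                                  = E⇒≢ pa refl
      ... | there (here p≡b)                           = p≢b p≡b
      ... | there (there (here p≡v₃))                  = p≢v₃ p≡v₃
      ... | there (there (there (here p≡v₁)))          = p∉ (here p≡v₁)
      ... | there (there (there (there (here p≡v₂))))  = p∉ (there (here p≡v₂))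

      triangle : ∀ {s} → s ≢ v₃ → E G s v₃ → ∃ λ q → q ≢ v₃ × E G s q × E G q v₃
      triangle {s} s≢v₃ sv₃ with s ∈? wings
      ... | yes (here refl)                         = v₂ , E⇒≢ e₂₃ , e₁₂ , e₂₃
      ... | yes (there (here refl))                 = v₁ , d₁₃ , E-sym e₁₂ , v₁v₃
      ... | yes (there (there (here refl)))         = v₅ , ≢-sym d₃₅ , e₄₅ , v₅v₃
      ... | yes (there (there (there (here refl)))) = v₄ , ≢-sym (E⇒≢ e₃₄) , E-sym e₄₅ , E-sym e₃₄
      ... | no s∉ with anotherNeighbour δ≥2 s v₃
      ...   | q , sq , q≢v₃ with E? q v₃
      ...     | yes qv₃ = q , q≢v₃ , sq , qv₃
      ...     | no q≁v₃ with anotherNeighbour δ≥2 q s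
      ...       | r , qr , r≢s =
        ⊥-elim (outer-path⇒⊥ (E-sym qr) (E-sym sq) sv₃ (∉wings-by-neighbour q∉ q≢v₃ (E-sym qr)) q∉ s∉
                             r≢s (λ { refl → q≁v₃ qr }) q≢v₃)
        where
        q∉ : q ∉ wings
        q∉ = ∉wings-by-neighbour s∉ s≢v₃ (E-sym sq)

      centre : ∀ x → x ≢ v₃ → E G x v₃
      centre x x≢v₃ with E? x v₃
      ... | yes xv₃ = xv₃
      ... | no x≁v₃ with crossingEdge (λ z → z ≟ v₃ ⊎-dec E? z v₃) (connected v₃ x) (inj₁ refl) [ x≢v₃ , x≁v₃ ]′
      ...   | s , t , s-near , t-far , st = ⊥-elim (escape s-near)
        where
        t∉ : t ∉ wings
        t∉ = t-far ∘ inj₂ ∘ wings-centre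

        escape : s ≡ v₃ ⊎ E G s v₃ → ⊥
        escape (inj₁ refl) = t-far (inj₂ (E-sym st))
        escape (inj₂ sv₃) with triangle (E⇒≢ sv₃) sv₃
        ... | q , q≢v₃ , sq , qv₃ =
          outer-path⇒⊥ (E-sym st) sq qv₃ t∉ s∉ (∉wings-by-neighbour s∉ (E⇒≢ sv₃) (E-sym sq))
                       (λ { refl → t-far (inj₂ qv₃) }) (t-far ∘ inj₁) (E⇒≢ sv₃)
          where
          s∉ : s ∉ wings
          s∉ = ∉wings-by-neighbour t∉ (t-far ∘ inj₁) st

      isFanCentre : IsFanCentre v₃
      isFanCentre = centre , partner
        where
        partner : ∀ x → x ≢ v₃ → OneNeighbourBesides v₃ x
        partner x x≢v₃ with triangle x≢v₃ (centre x x≢v₃)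
        ... | q , q≢v₃ , xq , qv₃ = q , q≢v₃ , xq , unique
          where
          unique : ∀ {q′} → q′ ≢ v₃ → E G x q′ → q′ ≡ q
          unique {q′} q′≢v₃ xq′ with q′ ≟ q
          ... | yes q′≡q = q′≡q
          ... | no q′≢q  =
            ⊥-elim (noCycle4 (xq , qv₃ , E-sym (centre q′ q′≢v₃) , E-sym xq′ , x≢v₃ , ≢-sym q′≢q))

    path₄⇒fanCentre : ContainsPath G 4 → ∃ IsFanCentre
    path₄⇒fanCentre hasP₄ with path₄⇒path₅ hasP₄
    ... | (_ ∷ _ ∷ v₃ ∷ _ ∷ _ ∷ [])
        , ((_ ∷ d₁₃ ∷ d₁₄ ∷ d₁₅ ∷ []) ∷ (_ ∷ d₂₄ ∷ d₂₅ ∷ []) ∷ (_ ∷ d₃₅ ∷ []) ∷ _)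
        , e₁₂ ∷ e₂₃ ∷ e₃₄ ∷ e₄₅ ∷ [-] = v₃ , Bowtie.isFanCentre e₁₂ e₂₃ e₃₄ e₄₅ d₁₃ d₁₄ d₁₅ d₂₄ d₂₅ d₃₅

5≤j+j⇒3≤j : ∀ j → 5 ≤ j + j → 3 ≤ j
5≤j+j⇒3≤j 0 ()
5≤j+j⇒3≤j 1 (s≤s (s≤s ()))
5≤j+j⇒3≤j 2 (s≤s (s≤s (s≤s (s≤s ()))))
5≤j+j⇒3≤j (suc (suc (suc j))) _ = s≤s (s≤s (s≤s z≤n))

lemma2p5 : (n : ℕ) → (G : Graph n) → 6 ≤ n → Connected G → MinDegreeAtLeast G 2
    → ¬ ContainsPath G 6 → ContainsPath G 4
    → (∀ x u v → degree G x ≡ 2 → E G x u → E G x v → u ≢ v → E G u v)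
    → (Σ ℕ λ i → 4 ≤ i × IsoTo G (i + 2) (bookAdj i))
      ⊎ (Σ ℕ λ k → n ≡ suc (k + k)) × (Σ ℕ λ j → 3 ≤ j × IsoTo G (suc (j + j)) (fanAdj j))
lemma2p5 1 _ (s≤s ()) _ _ _ _ _
lemma2p5 (suc (suc k)) G 6≤n connected δ≥2 noP₆ hasP₄ deg2⇒edge =
  ⊎-map (λ (_ , _ , _ , _ , C) →
           let _ , _ , spine = cycle4⇒bookSpine deg2⇒edge C
           in k , ≤-pred (≤-pred 6≤n) , bookSpine⇒IsoTo G spine)
        (λ noC4 →
           let _ , fan = path₄⇒fanCentre noC4 hasP₄
               j , n≡2j+1 , iso = fanCentre⇒IsoTo G fan
           in (j , n≡2j+1) , j , 5≤j+j⇒3≤j j (≤-pred (subst (6 ≤_) n≡2j+1 6≤n)) , iso)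
        (toSum (Basics.cycle4? G))
  where
  hypotheses : Hypotheses G
  hypotheses = record { noP₆ = noP₆ ; connected = connected ; 5<n = 6≤n ; δ≥2 = δ≥2 }

  open WithoutP₆ hypotheses
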